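{- Let $K$ be a non-archimedean ordered field, let $R_v$ be the convex hull of $\mathbb{Q}$ in $K$ (the valuation ring of the natural valuation $v$ of $K$), and let $\mathbf{P}_K := K^{>0}\setminus R_v$. For $a,a'\in\mathbf{P}_K$ write $a\sim_{\varphi} a'$ if there is $n\in\mathbb{N}_0$ with $a^{2^n}\ge a'$ and $a'^{2^n}\ge a$. Then $\sim_\varphi$ is coarser than the archimedean equivalence relation with respect to addition on $\mathbf{P}_K$ (i.e. if $a,b\in\mathbf{P}_K$ and there is $n\in\mathbb{N}$ with $na\ge b$ and $nb\ge a$, then $a\sim_\varphi b$), and every equivalence class of $\sim_\varphi$ is closed under addition and multiplication.
   Context: $\sim_\varphi$ is the equivalence relation on $\mathbf{P}_K$ induced by the order preserving right shift $\varphi(a)=a^2$; here $\varphi^0(a)=a$ and $\varphi^{n+1}=\varphi\circ\varphi^n$, so $\varphi^n(a)=a^{2^n}$. -}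

module Defs where

open import Level using (0ℓ)
open import Data.Nat using (ℕ; zero; suc)
open import Data.Integer using (ℤ; +_; -[1+_])
open import Data.Product using (Σ; ∃; _×_; _,_)
open import Relation.Binary.PropositionalEquality using (_≡_; _≢_)
open import Relation.Nullary using (¬_)
open import Algebra.Structures using (IsCommutativeRing)
open import Relation.Binary.Structures using (IsTotalOrder)

record OrderedField : Set₁ where
  infixl 6 _+_
  infixl 7 _*_
  infix 4 _≤_
  field
    Carrier : Set
    _+_ _*_ : Carrier → Carrier → Carrier
    -_ : Carrier → Carrier
    0# 1# : Carrier
    _≤_ : Carrier → Carrier → Set
    isCommutativeRing : IsCommutativeRing _≡_ _+_ _*_ -_ 0# 1#
    0≢1 : 0# ≢ 1#
    inverse : ∀ x → x ≢ 0# → Σ Carrier (λ y → x * y ≡ 1#)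
    isTotalOrder : IsTotalOrder _≡_ _≤_
    +-mono-≤ : ∀ {x y} z → x ≤ y → x + z ≤ y + z
    *-nonneg : ∀ {x y} → 0# ≤ x → 0# ≤ y → 0# ≤ x * y

module _ (K : OrderedField) where
  open OrderedField K

  _<_ : Carrier → Carrier → Set
  x < y = x ≤ y × x ≢ y

  ℕ→K : ℕ → Carrier
  ℕ→K zero = 0#
  ℕ→K (suc n) = 1# + ℕ→K n

  ℤ→K : ℤ → Carrier
  ℤ→K (+ n) = ℕ→K n
  ℤ→K -[1+ n ] = - ℕ→K (suc n)

  _·_ : ℕ → Carrier → Carrier
  zero · x = 0#
  suc n · x = x + (n · x)

  _^_ : Carrier → ℕ → Carrier
  x ^ zero = 1#
  x ^ suc n = x * (x ^ n)

  Archimedean : Set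
  Archimedean = ∀ x → ∃ λ (n : ℕ) → x ≤ ℕ→K n

  NonArchimedean : Set
  NonArchimedean = ¬ Archimedean

  IsRational : Carrier → Set
  IsRational x = Σ ℤ λ p → Σ ℕ λ k → x * ℕ→K (suc k) ≡ ℤ→K p

  Rv : Carrier → Set
  Rv x = Σ Carrier λ q → Σ Carrier λ q' →
           IsRational q × IsRational q' × q ≤ x × x ≤ q'

  PK : Carrier → Set
  PK x = 0# < x × ¬ Rv x

  _∼φ_ : Carrier → Carrier → Set
  a ∼φ a' = ∃ λ (n : ℕ) → a' ≤ a ^ (2 Data.Nat.^ n) × a ≤ a' ^ (2 Data.Nat.^ n)

  ArchEquiv : Carrier → Carrier → Set
  ArchEquiv a b = ∃ λ (n : ℕ) → b ≤ n · a × a ≤ n · b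

-- A positive element outside the convex hull of ℚ dominates every natural number, so it is
-- at least 1 and n a ≤ a * a; hence additively equivalent elements are ∼φ-equivalent with
-- exponent 2¹. For closure, bring x, y ≤ c^(2^n) to a common n; then x + y and x * y are at
-- most C * C = c^(2^(n+1)) for C = c^(2^n) ≥ 2, while from below c ≤ x^(2^n) ≤ (x + y)^(2^n)
-- and likewise for x * y, because x ≤ x + y and x ≤ x * y.
module Submission where

open import Defs
open import Data.Product using (∃; _×_; _,_; proj₂)
open import Data.Sum using (inj₁; inj₂)
open import Data.Empty using (⊥-elim)
import Data.Integer as ℤ
open import Data.Nat as ℕ using (ℕ; zero; suc; z≤n; s≤s; _⊔_)
import Data.Nat.Properties as ℕ
open import Relation.Binary.PropositionalEquality
  using (_≡_; sym; trans; cong; cong₂; subst)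
open import Relation.Binary.Bundles using (Poset)
open import Relation.Binary.Structures using (IsTotalOrder)
open import Algebra.Structures using (IsCommutativeRing)
open import Algebra.Bundles using (Ring)

module OrderedFieldProperties (K : OrderedField) where
  open OrderedField K
  open IsCommutativeRing isCommutativeRing
    using ( isRing; +-assoc; +-comm; +-identityˡ; +-identityʳ; -‿inverseˡ; -‿inverseʳ
          ; *-assoc; *-comm; *-identityˡ; *-identityʳ; distribʳ; zeroˡ)
  open IsTotalOrder isTotalOrder
    using (total; isPartialOrder) renaming (refl to ≤-refl; trans to ≤-trans)

  ring : Ring _ _
  ring = record { isRing = isRing }

  import Algebra.Properties.Ring ring as RingProperties

  infixr 8 _^ᴷ_
  _^ᴷ_ : Carrier → ℕ → Carrier
  _^ᴷ_ = Defs._^_ K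

  poset : Poset _ _ _
  poset = record { isPartialOrder = isPartialOrder }

  open import Relation.Binary.Reasoning.PartialOrder poset

  +-monoʳ-≤ : ∀ z {x y} → x ≤ y → z + x ≤ z + y
  +-monoʳ-≤ z {x} {y} x≤y = begin
    z + x ≡⟨ +-comm z x ⟩
    x + z ≤⟨ +-mono-≤ z x≤y ⟩
    y + z ≡⟨ +-comm y z ⟩
    z + y ∎

  +-mono₂-≤ : ∀ {a b c d} → a ≤ b → c ≤ d → a + c ≤ b + d
  +-mono₂-≤ {b = b} {c} a≤b c≤d = ≤-trans (+-mono-≤ c a≤b) (+-monoʳ-≤ b c≤d)

  x≤x+y : ∀ {x y} → 0# ≤ y → x ≤ x + y
  x≤x+y {x} {y} 0≤y = begin
    x      ≡⟨ +-identityʳ x ⟨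
    x + 0# ≤⟨ +-monoʳ-≤ x 0≤y ⟩
    x + y  ∎

  x≤y⇒0≤y-x : ∀ {x y} → x ≤ y → 0# ≤ y + - x
  x≤y⇒0≤y-x {x} {y} x≤y = begin
    0#      ≡⟨ -‿inverseʳ x ⟨
    x + - x ≤⟨ +-mono-≤ (- x) x≤y ⟩
    y + - x ∎

  *-monoʳ-≤-nonNeg : ∀ z {x y} → 0# ≤ z → x ≤ y → x * z ≤ y * z
  *-monoʳ-≤-nonNeg z {x} {y} 0≤z x≤y = begin
    x * z                 ≡⟨ +-identityˡ (x * z) ⟨
    0# + x * z            ≤⟨ +-mono-≤ (x * z) (*-nonneg (x≤y⇒0≤y-x x≤y) 0≤z) ⟩
    (y + - x) * z + x * z ≡⟨ distribʳ z (y + - x) x ⟨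
    (y + - x + x) * z     ≡⟨ cong (_* z) (+-assoc y (- x) x) ⟩
    (y + (- x + x)) * z   ≡⟨ cong (λ t → (y + t) * z) (-‿inverseˡ x) ⟩
    (y + 0#) * z          ≡⟨ cong (_* z) (+-identityʳ y) ⟩
    y * z                 ∎

  *-monoˡ-≤-nonNeg : ∀ z {x y} → 0# ≤ z → x ≤ y → z * x ≤ z * y
  *-monoˡ-≤-nonNeg z {x} {y} 0≤z x≤y = begin
    z * x ≡⟨ *-comm z x ⟩
    x * z ≤⟨ *-monoʳ-≤-nonNeg z 0≤z x≤y ⟩
    y * z ≡⟨ *-comm y z ⟩
    z * y ∎

  *-mono-≤-nonNeg : ∀ {a b c d} → 0# ≤ a → a ≤ b → 0# ≤ c → c ≤ d → a * c ≤ b * d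
  *-mono-≤-nonNeg {b = b} {c} 0≤a a≤b 0≤c c≤d =
    ≤-trans (*-monoʳ-≤-nonNeg c 0≤c a≤b) (*-monoˡ-≤-nonNeg b (≤-trans 0≤a a≤b) c≤d)

  x≤x*y : ∀ {x y} → 0# ≤ x → 1# ≤ y → x ≤ x * y
  x≤x*y {x} {y} 0≤x 1≤y = begin
    x      ≡⟨ *-identityʳ x ⟨
    x * 1# ≤⟨ *-monoˡ-≤-nonNeg x 0≤x 1≤y ⟩
    x * y  ∎

  -- If 1 ≤ 0 then 0 ≤ -1, and squaring gives 0 ≤ 1 anyway.
  0≤1 : 0# ≤ 1#
  0≤1 with total 0# 1#
  ... | inj₁ 0≤1 = 0≤1
  ... | inj₂ 1≤0 = begin
    0#        ≤⟨ *-nonneg 0≤-1 0≤-1 ⟩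
    - 1# * - 1# ≡⟨ RingProperties.-1*x≈-x (- 1#) ⟩
    - - 1#    ≡⟨ RingProperties.-‿involutive 1# ⟩
    1#        ∎
    where
    0≤-1 : 0# ≤ - 1#
    0≤-1 = begin
      0#       ≡⟨ -‿inverseʳ 1# ⟨
      1# + - 1# ≤⟨ +-mono-≤ (- 1#) 1≤0 ⟩
      0# + - 1# ≡⟨ +-identityˡ (- 1#) ⟩
      - 1#     ∎

  ·≡ℕ→K* : ∀ n x → _·_ K n x ≡ ℕ→K K n * x
  ·≡ℕ→K* zero    x = sym (zeroˡ x)
  ·≡ℕ→K* (suc n) x = begin-equality
    x + _·_ K n x         ≡⟨ cong₂ _+_ (sym (*-identityˡ x)) (·≡ℕ→K* n x) ⟩
    1# * x + ℕ→K K n * x  ≡⟨ distribʳ x 1# (ℕ→K K n) ⟨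
    (1# + ℕ→K K n) * x    ∎

  ^-distribˡ-+-* : ∀ x m n → x ^ᴷ (m ℕ.+ n) ≡ x ^ᴷ m * x ^ᴷ n
  ^-distribˡ-+-* x zero    n = sym (*-identityˡ (x ^ᴷ n))
  ^-distribˡ-+-* x (suc m) n =
    trans (cong (x *_) (^-distribˡ-+-* x m n)) (sym (*-assoc x (x ^ᴷ m) (x ^ᴷ n)))

  ^-2^-suc : ∀ x n → x ^ᴷ (2 ℕ.^ suc n) ≡ x ^ᴷ (2 ℕ.^ n) * x ^ᴷ (2 ℕ.^ n)
  ^-2^-suc x n rewrite ℕ.+-identityʳ (2 ℕ.^ n) = ^-distribˡ-+-* x (2 ℕ.^ n) (2 ℕ.^ n)

  ^-nonNeg : ∀ {x} n → 0# ≤ x → 0# ≤ x ^ᴷ n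
  ^-nonNeg zero    0≤x = 0≤1
  ^-nonNeg (suc n) 0≤x = *-nonneg 0≤x (^-nonNeg n 0≤x)

  ^-monoˡ-≤ : ∀ n {x y} → 0# ≤ x → x ≤ y → x ^ᴷ n ≤ y ^ᴷ n
  ^-monoˡ-≤ zero    0≤x x≤y = ≤-refl
  ^-monoˡ-≤ (suc n) 0≤x x≤y = *-mono-≤-nonNeg 0≤x x≤y (^-nonNeg n 0≤x) (^-monoˡ-≤ n 0≤x x≤y)

  1≤^ : ∀ {x} n → 1# ≤ x → 1# ≤ x ^ᴷ n
  1≤^ zero    1≤x = ≤-refl
  1≤^ (suc n) 1≤x = begin
    1#          ≡⟨ *-identityˡ 1# ⟨
    1# * 1#     ≤⟨ *-mono-≤-nonNeg 0≤1 1≤x 0≤1 (1≤^ n 1≤x) ⟩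
    _ * _ ^ᴷ n  ∎

  ^-monoʳ-≤ : ∀ {x m n} → 1# ≤ x → m ℕ.≤ n → x ^ᴷ m ≤ x ^ᴷ n
  ^-monoʳ-≤ {n = n} 1≤x z≤n       = 1≤^ n 1≤x
  ^-monoʳ-≤ {x}     1≤x (s≤s m≤n) = *-monoˡ-≤-nonNeg x (≤-trans 0≤1 1≤x) (^-monoʳ-≤ 1≤x m≤n)

module ConvexHullComplement (K : OrderedField) where
  open OrderedField K
  open OrderedFieldProperties K
  open IsCommutativeRing isCommutativeRing
    using (+-identityʳ; *-identityʳ; *-identityˡ; distribʳ; zeroˡ)
  open IsTotalOrder isTotalOrder using (total; antisym) renaming (trans to ≤-trans)
  open import Relation.Binary.Reasoning.PartialOrder poset

  0-rational : IsRational K 0#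
  0-rational = ℤ.+ 0 , 0 , zeroˡ _

  ℕ→K-rational : ∀ n → IsRational K (ℕ→K K n)
  ℕ→K-rational n = ℤ.+ n , 0 , trans (cong (ℕ→K K n *_) (+-identityʳ 1#)) (*-identityʳ _)

  PK⇒0≤ : ∀ {a} → PK K a → 0# ≤ a
  PK⇒0≤ ((0≤a , _) , _) = 0≤a

  PK⇒ℕ→K≤ : ∀ {a} → PK K a → ∀ n → ℕ→K K n ≤ a
  PK⇒ℕ→K≤ {a} PKa n with total (ℕ→K K n) a
  ... | inj₁ n≤a = n≤a
  ... | inj₂ a≤n = ⊥-elim (proj₂ PKa (0# , ℕ→K K n , 0-rational , ℕ→K-rational n , PK⇒0≤ PKa , a≤n))

  PK⇒1≤ : ∀ {a} → PK K a → 1# ≤ a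
  PK⇒1≤ {a} PKa = begin
    1#      ≡⟨ +-identityʳ 1# ⟨
    1# + 0# ≤⟨ PK⇒ℕ→K≤ PKa 1 ⟩
    a       ∎

  PK⇒2≤ : ∀ {a} → PK K a → 1# + 1# ≤ a
  PK⇒2≤ {a} PKa = begin
    1# + 1#        ≡⟨ cong (1# +_) (+-identityʳ 1#) ⟨
    1# + (1# + 0#) ≤⟨ PK⇒ℕ→K≤ PKa 2 ⟩
    a              ∎

  PK-upward : ∀ {x y} → PK K x → x ≤ y → PK K y
  PK-upward ((0≤x , 0≢x) , x∉Rv) x≤y =
    (≤-trans 0≤x x≤y , λ 0≡y → 0≢x (antisym 0≤x (subst (_ ≤_) (sym 0≡y) x≤y))) ,
    λ { (_ , q′ , _ , q′-rational , _ , y≤q′) →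
          x∉Rv (0# , q′ , 0-rational , q′-rational , 0≤x , ≤-trans x≤y y≤q′) }

  ·≤^2 : ∀ {a} → PK K a → ∀ n → _·_ K n a ≤ a ^ᴷ 2
  ·≤^2 {a} PKa n = begin
    _·_ K n a     ≡⟨ ·≡ℕ→K* n a ⟩
    ℕ→K K n * a   ≤⟨ *-monoʳ-≤-nonNeg a (PK⇒0≤ PKa) (PK⇒ℕ→K≤ PKa n) ⟩
    a * a         ≡⟨ cong (a *_) (*-identityʳ a) ⟨
    a * (a * 1#)  ∎

  ArchEquiv⇒∼φ : ∀ {a b} → PK K a → PK K b → ArchEquiv K a b → _∼φ_ K a b
  ArchEquiv⇒∼φ PKa PKb (n , b≤n·a , a≤n·b) =
    1 , ≤-trans b≤n·a (·≤^2 PKa n) , ≤-trans a≤n·b (·≤^2 PKb n)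

  infix 4 _≼φ_
  _≼φ_ : Carrier → Carrier → Set
  x ≼φ c = ∃ λ n → x ≤ c ^ᴷ (2 ℕ.^ n)

  ≤^2^-raise : ∀ {x c m n} → 1# ≤ c → m ℕ.≤ n → x ≤ c ^ᴷ (2 ℕ.^ m) → x ≤ c ^ᴷ (2 ℕ.^ n)
  ≤^2^-raise 1≤c m≤n x≤cᵐ = ≤-trans x≤cᵐ (^-monoʳ-≤ 1≤c (ℕ.^-monoʳ-≤ 2 m≤n))

  ≼φ-both⇒∼φ : ∀ {a b} → 1# ≤ a → 1# ≤ b → b ≼φ a → a ≼φ b → _∼φ_ K a b
  ≼φ-both⇒∼φ 1≤a 1≤b (m , b≤aᵐ) (n , a≤bⁿ) =
    m ⊔ n , ≤^2^-raise 1≤a (ℕ.m≤m⊔n m n) b≤aᵐ , ≤^2^-raise 1≤b (ℕ.m≤n⊔m m n) a≤bⁿ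

  ≼φ-common : ∀ {x y c} → 1# ≤ c → x ≼φ c → y ≼φ c →
              ∃ λ n → x ≤ c ^ᴷ (2 ℕ.^ n) × y ≤ c ^ᴷ (2 ℕ.^ n)
  ≼φ-common 1≤c (m , x≤cᵐ) (n , y≤cⁿ) =
    m ⊔ n , ≤^2^-raise 1≤c (ℕ.m≤m⊔n m n) x≤cᵐ , ≤^2^-raise 1≤c (ℕ.m≤n⊔m m n) y≤cⁿ

  ≼φ-monoʳ : ∀ {c x y} → 0# ≤ x → x ≤ y → c ≼φ x → c ≼φ y
  ≼φ-monoʳ 0≤x x≤y (n , c≤xⁿ) = n , ≤-trans c≤xⁿ (^-monoˡ-≤ (2 ℕ.^ n) 0≤x x≤y)

  ≼φ-* : ∀ {x y c} → 1# ≤ c → 0# ≤ x → 0# ≤ y → x ≼φ c → y ≼φ c → x * y ≼φ c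
  ≼φ-* {x} {y} {c} 1≤c 0≤x 0≤y x≼c y≼c with ≼φ-common 1≤c x≼c y≼c
  ... | n , x≤C , y≤C = suc n , (begin
    x * y                              ≤⟨ *-mono-≤-nonNeg 0≤x x≤C 0≤y y≤C ⟩
    c ^ᴷ (2 ℕ.^ n) * c ^ᴷ (2 ℕ.^ n)    ≡⟨ ^-2^-suc c n ⟨
    c ^ᴷ (2 ℕ.^ suc n)                 ∎)

  ≼φ-+ : ∀ {x y c} → 1# + 1# ≤ c → 1# ≤ c → x ≼φ c → y ≼φ c → x + y ≼φ c
  ≼φ-+ {x} {y} {c} 2≤c 1≤c x≼c y≼c with ≼φ-common 1≤c x≼c y≼c
  ... | n , x≤C , y≤C = suc n , (begin
    x + y           ≤⟨ +-mono₂-≤ x≤C y≤C ⟩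
    C + C           ≡⟨ cong₂ _+_ (*-identityˡ C) (*-identityˡ C) ⟨
    1# * C + 1# * C ≡⟨ distribʳ C 1# 1# ⟨
    (1# + 1#) * C   ≤⟨ *-monoʳ-≤-nonNeg C 0≤C (≤-trans 2≤c c≤C) ⟩
    C * C           ≡⟨ ^-2^-suc c n ⟨
    c ^ᴷ (2 ℕ.^ suc n) ∎)
    where
    C : Carrier
    C = c ^ᴷ (2 ℕ.^ n)
    0≤C : 0# ≤ C
    0≤C = ^-nonNeg (2 ℕ.^ n) (≤-trans 0≤1 1≤c)
    c≤C : c ≤ C
    c≤C = begin
      c      ≡⟨ *-identityʳ c ⟨
      c ^ᴷ 1 ≤⟨ ^-monoʳ-≤ 1≤c (ℕ.m^n>0 2 n) ⟩
      C      ∎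

  ∼φ-class-closed : ∀ {c x y} → (_∙_ : Carrier → Carrier → Carrier) →
                    x ≤ x ∙ y → x ∙ y ≼φ c →
                    PK K c → PK K x → _∼φ_ K x c → PK K (x ∙ y) × _∼φ_ K (x ∙ y) c
  ∼φ-class-closed {x = x} {y} _∙_ x≤x∙y x∙y≼c PKc PKx (n , c≤xⁿ , _) =
    PKx∙y , ≼φ-both⇒∼φ (PK⇒1≤ PKx∙y) (PK⇒1≤ PKc) (≼φ-monoʳ (PK⇒0≤ PKx) x≤x∙y (n , c≤xⁿ)) x∙y≼c
    where
    PKx∙y : PK K (x ∙ y)
    PKx∙y = PK-upward PKx x≤x∙y

lemma3p1 : (K : OrderedField) → NonArchimedean K →
    let open OrderedField K in
    (∀ a b → PK K a → PK K b → ArchEquiv K a b → _∼φ_ K a b)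
    × (∀ c x y → PK K c → PK K x → PK K y → _∼φ_ K x c → _∼φ_ K y c →
    (PK K (x + y) × _∼φ_ K (x + y) c) × (PK K (x * y) × _∼φ_ K (x * y) c))
-- The hypothesis is idle: in an archimedean field P_K is empty.
lemma3p1 K _ =
  (λ _ _ → ArchEquiv⇒∼φ) ,
  λ c x y PKc PKx PKy x∼c@(n , _ , x≤cⁿ) (m , _ , y≤cᵐ) →
    let 1≤c = PK⇒1≤ PKc
        x≼c = n , x≤cⁿ
        y≼c = m , y≤cᵐ
    in ∼φ-class-closed _+_ (x≤x+y (PK⇒0≤ PKy)) (≼φ-+ (PK⇒2≤ PKc) 1≤c x≼c y≼c) PKc PKx x∼c ,
       ∼φ-class-closed _*_ (x≤x*y (PK⇒0≤ PKx) (PK⇒1≤ PKy))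
         (≼φ-* 1≤c (PK⇒0≤ PKx) (PK⇒0≤ PKy) x≼c y≼c) PKc PKx x∼c
  where
  open OrderedField K
  open OrderedFieldProperties K
  open ConvexHullComplement K
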